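{- Let $A$ be a density-1 real and $B$ any real. Then: (i) $B\geq_g A$ if and only if there is a Turing functional $\varphi$ which only outputs 1's (for every real $X$ and number $n$, if $\varphi^X(n)\downarrow$ then $\varphi^X(n)=1$) such that for every generic oracle $(B)$ for $B$, $\varphi^{(B)}$ is a generic computation of $A$. (ii) $A\geq_g B$ if and only if there is a Turing functional $\varphi$ such that for every generic oracle $(A)$ for $A$ with $\mathrm{dom}((A))\subseteq A$, $\varphi^{(A)}$ is a generic computation of $B$.
   Context: Reals are subsets of $\mathbb{N}$; $n=\{0,\dots,n-1\}$; a real $A$ is density-1 if $\lim_{n\to\infty}|A\cap n|/n=1$. A partial oracle for a real $C$ is a set $(C)$ of triples $\langle n,x,l\rangle$ (coded as naturals, usable as a Turing oracle) such that $\langle n,0,l\rangle\in(C)$ implies $n\notin C$ and $\langle n,1,l\rangle\in(C)$ implies $n\in C$; $\mathrm{dom}((C))=\{n:\exists x,l\ \langle n,x,l\rangle\in(C)\}$. A generic oracle for $C$ is a partial oracle for $C$ with density-1 domain. $\varphi^X$ is a generic computation of $D$ if $\mathrm{dom}(\varphi^X)$ is density-1, $\varphi^X$ has values in $\{0,1\}$, and agrees with $D$ on its domain. $C\geq_g D$ if there is a single Turing functional $\varphi$ such that for every generic oracle $(C)$ for $C$, $\varphi^{(C)}$ is a generic computation of $D$. -}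

module Defs where

open import Data.Nat using (ℕ; zero; suc; _+_; _*_; _≤_; _<_)
open import Data.Bool using (Bool; true; false; if_then_else_)
open import Data.Fin using (Fin; toℕ)
open import Data.Fin.Subset using (Subset; _∈_; ∣_∣)
open import Data.Vec using (Vec; []; _∷_; lookup)
open import Data.Product using (Σ; ∃; _×_)
open import Relation.Binary.PropositionalEquality using (_≡_)

-- Reals are subsets of ℕ, represented by characteristic functions.

Real : Set
Real = ℕ → Bool

-- Density 1 for an arbitrary (possibly undecidable) set P ⊆ ℕ.
-- lim |P ∩ n| / n = 1, written out: for every ε = 1/(k+1) there is N
-- such that for all n ≥ N, |P ∩ n| / n ≥ k/(k+1).  Since P ∩ n need not
-- be decidable, "|P ∩ n| ≥ m" is expressed as "there is a subset S of
-- n = {0,…,n-1} with S ⊆ P and |S| ≥ m" (classically the same).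

Density1 : (ℕ → Set) → Set
Density1 P = ∀ (k : ℕ) → ∃ λ (N : ℕ) → ∀ (n : ℕ) → N ≤ n →
  Σ (Subset n) λ S → (∀ (i : Fin n) → i ∈ S → P (toℕ i))
                   × (k * n ≤ suc k * ∣ S ∣)

Density1Real : Real → Set
Density1Real A = Density1 (λ n → A n ≡ true)

tri : ℕ → ℕ
tri zero    = zero
tri (suc k) = suc k + tri k

pair : ℕ → ℕ → ℕ
pair a b = tri (a + b) + b

⟨_,_,_⟩ : ℕ → ℕ → ℕ → ℕ
⟨ n , x , l ⟩ = pair n (pair x l)

data Code : ℕ → Set where
  czero  : ∀ {n} → Code n
  csucc  : Code 1
  cproj  : ∀ {n} → Fin n → Code n
  ccomp  : ∀ {k n} → Code k → Vec (Code n) k → Code n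
  cprec  : ∀ {n} → Code n → Code (suc (suc n)) → Code (suc n)
  cmu    : ∀ {n} → Code (suc n) → Code n
  corac  : Code 1

bit : Bool → ℕ
bit b = if b then 1 else 0

mutual
  data Eval (X : Real) : ∀ {n} → Code n → Vec ℕ n → ℕ → Set where
    ev-zero : ∀ {n} {xs : Vec ℕ n} → Eval X czero xs 0
    ev-succ : ∀ {x} → Eval X csucc (x ∷ []) (suc x)
    ev-proj : ∀ {n} {i : Fin n} {xs} → Eval X (cproj i) xs (lookup xs i)
    ev-comp : ∀ {k n} {f : Code k} {gs : Vec (Code n) k} {xs ys v} →
              EvalVec X gs xs ys → Eval X f ys v → Eval X (ccomp f gs) xs v
    ev-rec0 : ∀ {n} {g : Code n} {h} {xs v} →
              Eval X g xs v → Eval X (cprec g h) (0 ∷ xs) v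
    ev-recS : ∀ {n} {g : Code n} {h} {y xs r v} →
              Eval X (cprec g h) (y ∷ xs) r → Eval X h (y ∷ r ∷ xs) v →
              Eval X (cprec g h) (suc y ∷ xs) v
    ev-mu   : ∀ {n} {f : Code (suc n)} {xs y} →
              Eval X f (y ∷ xs) 0 →
              (∀ z → z < y → Σ ℕ λ w → Eval X f (z ∷ xs) (suc w)) →
              Eval X (cmu f) xs y
    ev-orac : ∀ {x} → Eval X corac (x ∷ []) (bit (X x))

  data EvalVec (X : Real) {n} : ∀ {k} → Vec (Code n) k → Vec ℕ n → Vec ℕ k → Set where
    evv-[] : ∀ {xs} → EvalVec X [] xs []
    evv-∷  : ∀ {k} {g} {gs : Vec (Code n) k} {xs y ys} →
             Eval X g xs y → EvalVec X gs xs ys → EvalVec X (g ∷ gs) xs (y ∷ ys)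

TuringFunctional : Set
TuringFunctional = Code 1

_^_[_]⇓_ : TuringFunctional → Real → ℕ → ℕ → Set
φ ^ X [ n ]⇓ v = Eval X φ (n ∷ []) v

IsPartialOracle : Real → Real → Set
IsPartialOracle O C =
    (∀ n x l → O ⟨ n , x , l ⟩ ≡ true → x ≤ 1)
  × (∀ n l → O ⟨ n , 0 , l ⟩ ≡ true → C n ≡ false)
  × (∀ n l → O ⟨ n , 1 , l ⟩ ≡ true → C n ≡ true)

dom : Real → ℕ → Set
dom O n = ∃ λ x → ∃ λ l → O ⟨ n , x , l ⟩ ≡ true

IsGenericOracle : Real → Real → Set
IsGenericOracle O C = IsPartialOracle O C × Density1 (dom O)

IsGenericComputation : TuringFunctional → Real → Real → Set
IsGenericComputation φ X D =
    Density1 (λ n → ∃ λ v → φ ^ X [ n ]⇓ v)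
  × (∀ n v → φ ^ X [ n ]⇓ v → v ≤ 1)
  × (∀ n v → φ ^ X [ n ]⇓ v → v ≡ bit (D n))

_≥g_ : Real → Real → Set
C ≥g D = Σ TuringFunctional λ φ →
  ∀ (O : Real) → IsGenericOracle O C → IsGenericComputation φ O D

OnlyOutputsOnes : TuringFunctional → Set
OnlyOutputsOnes φ = ∀ (X : Real) (n v : ℕ) → φ ^ X [ n ]⇓ v → v ≡ 1

module Submission where

-- In each equivalence one direction is immediate; the other rests on a
-- construction.
--  (i)  Post-composing a witness ψ with a partial "pass only 1" functional
--       gives keepOnes ψ, which outputs 1 exactly where ψ outputs 1.  On the
--       density-1 set dom ψ ∩ A the output of ψ is 1, so keepOnes ψ is still
--       a generic computation of A (density 1 is closed under ∩).
--  (ii) From a generic oracle O for A we compute its positive part: O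
--       restricted to the triples ⟨n,1,l⟩.  It is again a generic oracle for
--       A (its domain contains dom O ∩ A) and its domain lies inside A.  A
--       functional φ is simulated relative to O by replacing each oracle query
--       m by "O m and m is a positive triple", the latter decided by a
--       bounded search through the Cantor pairing.

open import Defs
open import Data.Bool using (Bool; true; false; _∧_; _∨_)
open import Data.Bool.Properties using (∨-zeroʳ; ∧-conicalˡ; ∧-conicalʳ; T-≡)
open import Data.Empty using (⊥-elim)
open import Data.Fin using (Fin; toℕ; zero; suc; #_)
open import Data.Fin.Subset using (Subset; _∈_; ∣_∣; _∩_)
open import Data.Fin.Subset.Properties using (x∈p∩q⁻)
open import Data.Nat using (ℕ; zero; suc; _+_; _*_; _∸_; _≤_; _<_; _⊔_; _≡ᵇ_; pred; z≤n; s≤s)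
open import Data.Nat.Properties
open import Data.Nat.Solver using (module +-*-Solver)
open import Data.Product using (Σ; ∃; ∃₂; _×_; _,_; proj₁; proj₂)
open import Data.Sum using (inj₁; inj₂)
open import Data.Vec using (Vec; []; _∷_; lookup; tabulate)
open import Data.Vec.Properties using (tabulate∘lookup)
open import Function.Bundles using (_⇔_; mk⇔; module Equivalence)
open import Relation.Binary using (tri<; tri≈; tri>)
open import Relation.Binary.PropositionalEquality

∣p∣+∣q∣≤∣p∩q∣+n : ∀ {n} (S T : Subset n) → ∣ S ∣ + ∣ T ∣ ≤ ∣ S ∩ T ∣ + n
∣p∣+∣q∣≤∣p∩q∣+n [] [] = z≤n
∣p∣+∣q∣≤∣p∩q∣+n {suc n} (true ∷ S) (true ∷ T) =
  s≤s (subst₂ _≤_ (sym (+-suc ∣ S ∣ ∣ T ∣)) (sym (+-suc _ n)) (s≤s (∣p∣+∣q∣≤∣p∩q∣+n S T)))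
∣p∣+∣q∣≤∣p∩q∣+n {suc n} (true ∷ S) (false ∷ T) =
  subst (suc (∣ S ∣ + ∣ T ∣) ≤_) (sym (+-suc _ n)) (s≤s (∣p∣+∣q∣≤∣p∩q∣+n S T))
∣p∣+∣q∣≤∣p∩q∣+n {suc n} (false ∷ S) (true ∷ T) =
  subst₂ _≤_ (sym (+-suc ∣ S ∣ ∣ T ∣)) (sym (+-suc _ n)) (s≤s (∣p∣+∣q∣≤∣p∩q∣+n S T))
∣p∣+∣q∣≤∣p∩q∣+n {suc n} (false ∷ S) (false ∷ T) =
  ≤-trans (∣p∣+∣q∣≤∣p∩q∣+n S T) (+-monoʳ-≤ _ (n≤1+n n))

-- If s, t ≥ (2k+1)/(2k+2)·n and s + t ≤ i + n, then i ≥ k/(k+1)·n: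
-- intersecting two sets of relative size 1-ε/2 leaves relative size 1-ε.
intersection-ratio : ∀ k n s t i →
  suc (k + k) * n ≤ suc (suc (k + k)) * s →
  suc (k + k) * n ≤ suc (suc (k + k)) * t →
  s + t ≤ i + n → k * n ≤ suc k * i
intersection-ratio k n s t i hs ht hst =
  *-cancelˡ-≤ 2 (+-cancelʳ-≤ (suc K * n) (2 * (k * n)) (2 * (suc k * i)) doubled)
  where
  open +-*-Solver
  open ≤-Reasoning
  K : ℕ
  K = suc (k + k)
  doubled : 2 * (k * n) + suc K * n ≤ 2 * (suc k * i) + suc K * n
  doubled = begin
    2 * (k * n) + suc K * n
      ≡⟨ solve 2 (λ k n → con 2 :* (k :* n) :+ (con 2 :+ (k :+ k)) :* n
                      := (con 1 :+ (k :+ k)) :* n :+ (con 1 :+ (k :+ k)) :* n) refl k n ⟩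
    K * n + K * n         ≤⟨ +-mono-≤ hs ht ⟩
    suc K * s + suc K * t ≡⟨ sym (*-distribˡ-+ (suc K) s t) ⟩
    suc K * (s + t)       ≤⟨ *-monoʳ-≤ (suc K) hst ⟩
    suc K * (i + n)
      ≡⟨ solve 3 (λ k i n → (con 2 :+ (k :+ k)) :* (i :+ n)
                      := con 2 :* ((con 1 :+ k) :* i) :+ (con 2 :+ (k :+ k)) :* n) refl k i n ⟩
    2 * (suc k * i) + suc K * n ∎

Density1-∩ : ∀ {P Q R : ℕ → Set} → (∀ n → P n → Q n → R n) →
             Density1 P → Density1 Q → Density1 R
Density1-∩ {P} {Q} {R} P∩Q⊆R dP dQ k with dP (suc (k + k)) | dQ (suc (k + k))
... | N₁ , largeP | N₂ , largeQ = N₁ ⊔ N₂ , λ n N≤n →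
  intersect n (largeP n (≤-trans (m≤m⊔n N₁ N₂) N≤n)) (largeQ n (≤-trans (m≤n⊔m N₁ N₂) N≤n))
  where
  Witness : (ℕ → Set) → ℕ → ℕ → Set
  Witness X k n = Σ (Subset n) λ S → (∀ i → i ∈ S → X (toℕ i)) × (k * n ≤ suc k * ∣ S ∣)
  intersect : ∀ n → Witness P (suc (k + k)) n → Witness Q (suc (k + k)) n → Witness R k n
  intersect n (S , S⊆P , hS) (T , T⊆Q , hT) =
    S ∩ T ,
    (λ i i∈S∩T → let (i∈S , i∈T) = x∈p∩q⁻ S T i∈S∩T in P∩Q⊆R (toℕ i) (S⊆P i i∈S) (T⊆Q i i∈T)) ,
    intersection-ratio k n (∣ S ∣) (∣ T ∣) (∣ S ∩ T ∣) hS hT (∣p∣+∣q∣≤∣p∩q∣+n S T)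

Density1-mono : ∀ {P Q : ℕ → Set} → (∀ n → P n → Q n) → Density1 P → Density1 Q
Density1-mono P⊆Q dP k with dP k
... | N , large = N , λ n N≤n → let (S , S⊆P , hS) = large n N≤n
                                in S , (λ i i∈S → P⊆Q (toℕ i) (S⊆P i i∈S)) , hS

-- Determinism: an oracle computation has at most one value.  Needed to read
-- off the value of an auxiliary code inside a given computation.

mutual
  Eval-deterministic : ∀ {X n} (c : Code n) {xs v w} → Eval X c xs v → Eval X c xs w → v ≡ w
  Eval-deterministic czero ev-zero ev-zero = refl
  Eval-deterministic csucc ev-succ ev-succ = refl
  Eval-deterministic (cproj i) ev-proj ev-proj = refl
  Eval-deterministic corac ev-orac ev-orac = refl
  Eval-deterministic (ccomp f gs) (ev-comp args out) (ev-comp args′ out′)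
    with EvalVec-deterministic gs args args′
  ... | refl = Eval-deterministic f out out′
  Eval-deterministic (cprec g h) (ev-rec0 base) (ev-rec0 base′) = Eval-deterministic g base base′
  Eval-deterministic (cprec g h) (ev-recS prev step) (ev-recS prev′ step′)
    with Eval-deterministic (cprec g h) prev prev′
  ... | refl = Eval-deterministic h step step′
  -- a search stops at the first zero, so two stopping points cannot differ
  Eval-deterministic (cmu f) (ev-mu {y = y} zero-y below-y) (ev-mu {y = y′} zero-y′ below-y′)
    with <-cmp y y′
  ... | tri< y<y′ _ _ = ⊥-elim (0≢1+n (Eval-deterministic f zero-y (proj₂ (below-y′ y y<y′))))
  ... | tri≈ _ y≡y′ _ = y≡y′
  ... | tri> _ _ y′<y = ⊥-elim (0≢1+n (Eval-deterministic f zero-y′ (proj₂ (below-y y′ y′<y))))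

  EvalVec-deterministic : ∀ {X n k} (gs : Vec (Code n) k) {xs ys zs} →
                          EvalVec X gs xs ys → EvalVec X gs xs zs → ys ≡ zs
  EvalVec-deterministic [] evv-[] evv-[] = refl
  EvalVec-deterministic (g ∷ gs) (evv-∷ e es) (evv-∷ e′ es′) =
    cong₂ _∷_ (Eval-deterministic g e e′) (EvalVec-deterministic gs es es′)

-- Primitive recursive codes.  None of them queries the oracle; truth values
-- are represented by bits (bit false = 0, bit true = 1).

one : ∀ {n} → Code n
one = ccomp csucc (czero ∷ [])

addC : Code 2
addC = cprec (cproj (# 0)) (ccomp csucc (cproj (# 1) ∷ []))

triC : Code 1
triC = cprec czero (ccomp addC (ccomp csucc (cproj (# 0) ∷ []) ∷ cproj (# 1) ∷ []))

pairC : Code 2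
pairC = ccomp addC (ccomp triC (addC ∷ []) ∷ cproj (# 1) ∷ [])

predC : Code 1
predC = cprec czero (cproj (# 0))

monusC : Code 2
monusC = cprec (cproj (# 0)) (ccomp predC (cproj (# 1) ∷ []))

isZeroC : Code 1
isZeroC = cprec one czero

-- (a , b) ↦ bit (a ≡ᵇ b), as "the distance (a ∸ b) + (b ∸ a) is zero"
eqC : Code 2
eqC = ccomp isZeroC (ccomp addC (ccomp monusC (cproj (# 1) ∷ cproj (# 0) ∷ [])
                              ∷ ccomp monusC (cproj (# 0) ∷ cproj (# 1) ∷ []) ∷ []) ∷ [])

orC : Code 2
orC = cprec (cproj (# 0)) one

andC : Code 2
andC = cprec czero (cproj (# 2))

anyBelow : (ℕ → Bool) → ℕ → Bool
anyBelow p zero = false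
anyBelow p (suc t) = anyBelow p t ∨ p t

∃<C : ∀ {n} → Code (suc n) → Code (suc n)
∃<C {n} f = cprec czero (ccomp orC (cproj (# 1) ∷ ccomp f (cproj zero ∷ skipTwo) ∷ []))
  where
  -- the arguments (z , r , xs) of a recursion step, minus the recursive value r
  skipTwo : Vec (Code (suc (suc n))) n
  skipTwo = tabulate (λ i → cproj (suc (suc i)))

anyBelow-sound : ∀ p t → anyBelow p t ≡ true → ∃ λ z → z < t × p z ≡ true
anyBelow-sound p (suc t) found with anyBelow p t in below | p t in here
... | true  | _    = let (z , z<t , pz) = anyBelow-sound p t below in z , m<n⇒m<1+n z<t , pz
... | false | true = t , n<1+n t , here

anyBelow-complete : ∀ p {z} t → z < t → p z ≡ true → anyBelow p t ≡ true
anyBelow-complete p (suc t) z<1+t pz with m<1+n⇒m<n∨m≡n z<1+t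
... | inj₁ z<t  rewrite anyBelow-complete p t z<t pz = refl
... | inj₂ refl rewrite pz = ∨-zeroʳ (anyBelow p t)

distance≡ᵇ0 : ∀ a b → ((a ∸ b + (b ∸ a)) ≡ᵇ 0) ≡ (a ≡ᵇ b)
distance≡ᵇ0 zero    zero    = refl
distance≡ᵇ0 zero    (suc b) = refl
distance≡ᵇ0 (suc a) zero    = refl
distance≡ᵇ0 (suc a) (suc b) = distance≡ᵇ0 a b

module Semantics {X : Real} where

  oneE : ∀ {n} {xs : Vec ℕ n} → Eval X one xs 1
  oneE = ev-comp (evv-∷ ev-zero evv-[]) ev-succ

  addE : ∀ a b → Eval X addC (a ∷ b ∷ []) (a + b)
  addE zero    b = ev-rec0 ev-proj
  addE (suc a) b = ev-recS (addE a b) (ev-comp (evv-∷ ev-proj evv-[]) ev-succ)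

  triE : ∀ k → Eval X triC (k ∷ []) (tri k)
  triE zero    = ev-rec0 ev-zero
  triE (suc k) = ev-recS (triE k)
    (ev-comp (evv-∷ (ev-comp (evv-∷ ev-proj evv-[]) ev-succ) (evv-∷ ev-proj evv-[])) (addE (suc k) (tri k)))

  pairE : ∀ a b → Eval X pairC (a ∷ b ∷ []) (pair a b)
  pairE a b = ev-comp (evv-∷ (ev-comp (evv-∷ (addE a b) evv-[]) (triE (a + b))) (evv-∷ ev-proj evv-[]))
                      (addE (tri (a + b)) b)

  predE : ∀ y → Eval X predC (y ∷ []) (pred y)
  predE zero    = ev-rec0 ev-zero
  predE (suc y) = ev-recS (predE y) ev-proj

  monusE : ∀ b a → Eval X monusC (b ∷ a ∷ []) (a ∸ b)
  monusE zero    a = ev-rec0 ev-proj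
  monusE (suc b) a = subst (Eval X monusC (suc b ∷ a ∷ [])) (pred[m∸n]≡m∸[1+n] a b)
    (ev-recS (monusE b a) (ev-comp (evv-∷ ev-proj evv-[]) (predE (a ∸ b))))

  isZeroE : ∀ y → Eval X isZeroC (y ∷ []) (bit (y ≡ᵇ 0))
  isZeroE zero    = ev-rec0 oneE
  isZeroE (suc y) = ev-recS (isZeroE y) ev-zero

  eqE : ∀ a b → Eval X eqC (a ∷ b ∷ []) (bit (a ≡ᵇ b))
  eqE a b = subst (λ e → Eval X eqC (a ∷ b ∷ []) (bit e)) (distance≡ᵇ0 a b)
    (ev-comp (evv-∷ (ev-comp (evv-∷ (ev-comp (evv-∷ ev-proj (evv-∷ ev-proj evv-[])) (monusE b a))
                             (evv-∷ (ev-comp (evv-∷ ev-proj (evv-∷ ev-proj evv-[])) (monusE a b)) evv-[]))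
                     (addE (a ∸ b) (b ∸ a))) evv-[])
             (isZeroE _))

  orE : ∀ a b → Eval X orC (bit a ∷ bit b ∷ []) (bit (a ∨ b))
  orE false b = ev-rec0 ev-proj
  orE true  b = ev-recS (ev-rec0 ev-proj) oneE

  andE : ∀ a b → Eval X andC (bit a ∷ bit b ∷ []) (bit (a ∧ b))
  andE false b = ev-rec0 ev-zero
  andE true  b = ev-recS (ev-rec0 ev-zero) ev-proj

  projectionsE : ∀ {m n} (g : Fin n → Fin m) (ys : Vec ℕ m) →
                 EvalVec X (tabulate (λ i → cproj (g i))) ys (tabulate (λ i → lookup ys (g i)))
  projectionsE {n = zero}  g ys = evv-[]
  projectionsE {n = suc n} g ys = evv-∷ ev-proj (projectionsE (λ i → g (suc i)) ys)

  ∃<E : ∀ {n} (f : Code (suc n)) (p : ℕ → Bool) {xs : Vec ℕ n} →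
        (∀ z → Eval X f (z ∷ xs) (bit (p z))) →
        ∀ t → Eval X (∃<C f) (t ∷ xs) (bit (anyBelow p t))
  ∃<E f p {xs} fE zero    = ev-rec0 ev-zero
  ∃<E f p {xs} fE (suc t) = ev-recS (∃<E f p fE t)
    (ev-comp (evv-∷ ev-proj (evv-∷ (ev-comp (evv-∷ ev-proj skipTwoE) (fE t)) evv-[]))
             (orE (anyBelow p t) (p t)))
    where
    skipTwoE : EvalVec X (tabulate (λ i → cproj (suc (suc i)))) (t ∷ bit (anyBelow p t) ∷ xs) xs
    skipTwoE = subst (EvalVec X _ _) (tabulate∘lookup xs) (projectionsE (λ i → suc (suc i)) _)

tri-mono : ∀ m n → m ≤ n → tri m ≤ tri n
tri-mono zero    n       _       = z≤n
tri-mono (suc m) (suc n) (s≤s p) = +-mono-≤ (s≤s p) (tri-mono m n p)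

n≤tri : ∀ s → s ≤ tri s
n≤tri zero    = z≤n
n≤tri (suc s) = m≤m+n (suc s) (tri s)

-- pair a b lies in [tri (a + b), tri (a + b + 1)), so a + b is determined
pair<tri : ∀ a b → pair a b < tri (suc (a + b))
pair<tri a b = begin-strict
  tri (a + b) + b       ≤⟨ +-monoʳ-≤ (tri (a + b)) (m≤n+m b a) ⟩
  tri (a + b) + (a + b) ≡⟨ +-comm (tri (a + b)) (a + b) ⟩
  (a + b) + tri (a + b) <⟨ n<1+n _ ⟩
  tri (suc (a + b))     ∎
  where open ≤-Reasoning

pair-sum-injective : ∀ a b c d → pair a b ≡ pair c d → a + b ≡ c + d
pair-sum-injective a b c d e with <-cmp (a + b) (c + d)
... | tri≈ _ s≡s′ _ = s≡s′
... | tri< s<s′ _ _ = ⊥-elim (<⇒≢ (≤-trans (pair<tri a b) (≤-trans (tri-mono _ _ s<s′) (m≤m+n _ d))) e)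
... | tri> _ _ s>s′ = ⊥-elim (<⇒≢ (≤-trans (pair<tri c d) (≤-trans (tri-mono _ _ s>s′) (m≤m+n _ b))) (sym e))

pair-injective : ∀ a b c d → pair a b ≡ pair c d → a ≡ c × b ≡ d
pair-injective a b c d e = a≡c , b≡d
  where
  sums : a + b ≡ c + d
  sums = pair-sum-injective a b c d e
  b≡d : b ≡ d
  b≡d = +-cancelˡ-≡ (tri (a + b)) b d (trans e (cong (λ s → tri s + d) (sym sums)))
  a≡c : a ≡ c
  a≡c = +-cancelʳ-≡ b a c (trans sums (cong (c +_) (sym b≡d)))

triple-middle-injective : ∀ n x l n′ x′ l′ → ⟨ n , x , l ⟩ ≡ ⟨ n′ , x′ , l′ ⟩ → x ≡ x′
triple-middle-injective n x l n′ x′ l′ e =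
  proj₁ (pair-injective x l x′ l′ (proj₂ (pair-injective n (pair x l) n′ (pair x′ l′) e)))

≤pairˡ : ∀ a b → a ≤ pair a b
≤pairˡ a b = ≤-trans (m≤m+n a b) (≤-trans (n≤tri (a + b)) (m≤m+n _ b))

≤pairʳ : ∀ a b → b ≤ pair a b
≤pairʳ a b = m≤n+m b (tri (a + b))

-- Positive queries: codes of triples ⟨n,1,l⟩, i.e. assertions "n ∈ C".

IsPositiveQuery : ℕ → Set
IsPositiveQuery m = ∃₂ λ n l → ⟨ n , 1 , l ⟩ ≡ m

-- both components of a positive query are bounded by it, so search suffices
positiveQuery? : ℕ → Bool
positiveQuery? m = anyBelow (λ n → anyBelow (λ l → ⟨ n , 1 , l ⟩ ≡ᵇ m) (suc m)) (suc m)

positiveQuery?-sound : ∀ m → positiveQuery? m ≡ true → IsPositiveQuery m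
positiveQuery?-sound m yes =
  let (n , _ , inner) = anyBelow-sound _ (suc m) yes
      (l , _ , same)  = anyBelow-sound _ (suc m) inner
  in n , l , ≡ᵇ⇒≡ _ m (Equivalence.from T-≡ same)

positiveQuery?-complete : ∀ n l → positiveQuery? ⟨ n , 1 , l ⟩ ≡ true
positiveQuery?-complete n l =
  anyBelow-complete _ (suc m) (s≤s (≤pairˡ n _))
    (anyBelow-complete _ (suc m) (s≤s (≤-trans (≤pairʳ 1 l) (≤pairʳ n _)))
      (Equivalence.to T-≡ (≡⇒≡ᵇ m m refl)))
  where
  m : ℕ
  m = ⟨ n , 1 , l ⟩

isTripleC : Code 3
isTripleC = ccomp eqC (ccomp pairC (cproj (# 1) ∷ ccomp pairC (one ∷ cproj (# 0) ∷ []) ∷ [])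
                       ∷ cproj (# 2) ∷ [])

hasTripleC : Code 2
hasTripleC = ccomp (∃<C isTripleC) (ccomp csucc (cproj (# 1) ∷ []) ∷ cproj (# 0) ∷ cproj (# 1) ∷ [])

positiveQueryC : Code 1
positiveQueryC = ccomp (∃<C hasTripleC) (ccomp csucc (cproj (# 0) ∷ []) ∷ cproj (# 0) ∷ [])

positiveQueryE : ∀ {X} m → Eval X positiveQueryC (m ∷ []) (bit (positiveQuery? m))
positiveQueryE {X} m = ev-comp (evv-∷ (ev-comp (evv-∷ ev-proj evv-[]) ev-succ) (evv-∷ ev-proj evv-[]))
                           (∃<E hasTripleC _ hasTripleE (suc m))
  where
  open Semantics
  isTripleE : ∀ n l → Eval X isTripleC (l ∷ n ∷ m ∷ []) (bit (⟨ n , 1 , l ⟩ ≡ᵇ m))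
  isTripleE n l = ev-comp
    (evv-∷ (ev-comp (evv-∷ ev-proj (evv-∷ (ev-comp (evv-∷ oneE (evv-∷ ev-proj evv-[])) (pairE 1 l)) evv-[]))
                    (pairE n (pair 1 l)))
           (evv-∷ ev-proj evv-[]))
    (eqE _ m)
  hasTripleE : ∀ n → Eval X hasTripleC (n ∷ m ∷ []) (bit (anyBelow (λ l → ⟨ n , 1 , l ⟩ ≡ᵇ m) (suc m)))
  hasTripleE n = ev-comp (evv-∷ (ev-comp (evv-∷ ev-proj evv-[]) ev-succ) (evv-∷ ev-proj (evv-∷ ev-proj evv-[])))
                         (∃<E isTripleC _ (isTripleE n) (suc m))

mutual
  restrict : ∀ {n} → Code 1 → Code n → Code n
  restrict Q czero        = czero
  restrict Q csucc        = csucc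
  restrict Q (cproj i)    = cproj i
  restrict Q (ccomp f gs) = ccomp (restrict Q f) (restrictVec Q gs)
  restrict Q (cprec g h)  = cprec (restrict Q g) (restrict Q h)
  restrict Q (cmu f)      = cmu (restrict Q f)
  restrict Q corac        = ccomp andC (corac ∷ Q ∷ [])

  restrictVec : ∀ {n k} → Code 1 → Vec (Code n) k → Vec (Code n) k
  restrictVec Q []       = []
  restrictVec Q (g ∷ gs) = restrict Q g ∷ restrictVec Q gs

module Restriction (O : Real) (Q : Code 1) (q : ℕ → Bool)
                   (QE : ∀ m → Eval O Q (m ∷ []) (bit (q m))) where

  O∧q : Real
  O∧q m = O m ∧ q m

  mutual
    restrict-sound : ∀ {n} (c : Code n) {xs v} → Eval O (restrict Q c) xs v → Eval O∧q c xs v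
    restrict-sound czero ev-zero = ev-zero
    restrict-sound csucc ev-succ = ev-succ
    restrict-sound (cproj i) ev-proj = ev-proj
    restrict-sound (ccomp f gs) (ev-comp args out) = ev-comp (restrictVec-sound gs args) (restrict-sound f out)
    restrict-sound (cprec g h) (ev-rec0 base) = ev-rec0 (restrict-sound g base)
    restrict-sound (cprec g h) (ev-recS prev step) =
      ev-recS (restrict-sound (cprec g h) prev) (restrict-sound h step)
    restrict-sound (cmu f) (ev-mu stop below) =
      ev-mu (restrict-sound f stop) (λ z z<y → proj₁ (below z z<y) , restrict-sound f (proj₂ (below z z<y)))
    restrict-sound corac {x ∷ []} (ev-comp (evv-∷ ev-orac (evv-∷ Qx evv-[])) conj)
      with Eval-deterministic Q Qx (QE x)
    ... | refl = subst (Eval O∧q corac (x ∷ []))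
                       (Eval-deterministic andC (Semantics.andE (O x) (q x)) conj) ev-orac

    restrictVec-sound : ∀ {n k} (gs : Vec (Code n) k) {xs ys} →
                        EvalVec O (restrictVec Q gs) xs ys → EvalVec O∧q gs xs ys
    restrictVec-sound [] evv-[] = evv-[]
    restrictVec-sound (g ∷ gs) (evv-∷ e es) = evv-∷ (restrict-sound g e) (restrictVec-sound gs es)

  mutual
    restrict-complete : ∀ {n} (c : Code n) {xs v} → Eval O∧q c xs v → Eval O (restrict Q c) xs v
    restrict-complete czero ev-zero = ev-zero
    restrict-complete csucc ev-succ = ev-succ
    restrict-complete (cproj i) ev-proj = ev-proj
    restrict-complete (ccomp f gs) (ev-comp args out) =
      ev-comp (restrictVec-complete gs args) (restrict-complete f out)
    restrict-complete (cprec g h) (ev-rec0 base) = ev-rec0 (restrict-complete g base)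
    restrict-complete (cprec g h) (ev-recS prev step) =
      ev-recS (restrict-complete (cprec g h) prev) (restrict-complete h step)
    restrict-complete (cmu f) (ev-mu stop below) =
      ev-mu (restrict-complete f stop) (λ z z<y → proj₁ (below z z<y) , restrict-complete f (proj₂ (below z z<y)))
    restrict-complete corac {x ∷ []} ev-orac =
      ev-comp (evv-∷ ev-orac (evv-∷ (QE x) evv-[])) (Semantics.andE (O x) (q x))

    restrictVec-complete : ∀ {n k} (gs : Vec (Code n) k) {xs ys} →
                           EvalVec O∧q gs xs ys → EvalVec O (restrictVec Q gs) xs ys
    restrictVec-complete [] evv-[] = evv-[]
    restrictVec-complete (g ∷ gs) (evv-∷ e es) = evv-∷ (restrict-complete g e) (restrictVec-complete gs es)

  restrict-generic : ∀ {D} φ → IsGenericComputation φ O∧q D → IsGenericComputation (restrict Q φ) O D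
  restrict-generic φ (dφ , bits , correct) =
    Density1-mono {λ n → ∃ λ v → φ ^ O∧q [ n ]⇓ v} (λ n (v , out) → v , restrict-complete φ out) dφ ,
    (λ n v out → bits n v (restrict-sound φ out)) ,
    (λ n v out → correct n v (restrict-sound φ out))

positivePart : Real → Real
positivePart O m = O m ∧ positiveQuery? m

positivePart-true : ∀ O n x l → positivePart O ⟨ n , x , l ⟩ ≡ true → O ⟨ n , x , l ⟩ ≡ true × x ≡ 1
positivePart-true O n x l yes =
  ∧-conicalˡ _ _ yes ,
  let (n′ , l′ , e) = positiveQuery?-sound _ (∧-conicalʳ (O ⟨ n , x , l ⟩) _ yes)
  in sym (triple-middle-injective n′ 1 l′ n x l e)

positivePart-keeps : ∀ O n l → O ⟨ n , 1 , l ⟩ ≡ true → positivePart O ⟨ n , 1 , l ⟩ ≡ true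
positivePart-keeps O n l yes rewrite yes = positiveQuery?-complete n l

module _ {O C : Real} (partial : IsPartialOracle O C) where

  private
    valid = proj₁ partial
    negative = proj₁ (proj₂ partial)
    positive = proj₂ (proj₂ partial)

  positivePart-partial : IsPartialOracle (positivePart O) C
  positivePart-partial =
    (λ n x l yes → valid n x l (proj₁ (positivePart-true O n x l yes))) ,
    (λ n l yes → ⊥-elim (0≢1+n (proj₂ (positivePart-true O n 0 l yes)))) ,
    (λ n l yes → positive n l (proj₁ (positivePart-true O n 1 l yes)))

  positivePart-dom⊆ : ∀ n → dom (positivePart O) n → C n ≡ true
  positivePart-dom⊆ n (x , l , yes) with positivePart-true O n x l yes
  ... | O-yes , refl = positive n l O-yes

  positivePart-dom⊇ : ∀ n → dom O n → C n ≡ true → dom (positivePart O) n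
  positivePart-dom⊇ n (0 , l , yes) n∈C with trans (sym n∈C) (negative n l yes)
  ... | ()
  positivePart-dom⊇ n (1 , l , yes) n∈C = 1 , l , positivePart-keeps O n l yes
  positivePart-dom⊇ n (suc (suc x) , l , yes) n∈C with valid n (suc (suc x)) l yes
  ... | s≤s ()

positivePart-generic : ∀ {O C} → Density1Real C → IsGenericOracle O C → IsGenericOracle (positivePart O) C
positivePart-generic {O} {C} dC (partial , dDom) =
  positivePart-partial {O} partial ,
  Density1-∩ {dom O} {λ n → C n ≡ true} {dom (positivePart O)} (positivePart-dom⊇ {O} partial) dDom dC

notOneC : Code 1
notOneC = cprec one (cproj (# 0))

notOne-zero : ∀ {X w} → Eval X notOneC (w ∷ []) 0 → w ≡ 1
notOne-zero (ev-rec0 (ev-comp (evv-∷ ev-zero evv-[]) ()))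
notOne-zero (ev-recS _ ev-proj) = refl

-- the unbounded search for a zero of the constant notOne w
ifOne : Code 1
ifOne = cmu (ccomp notOneC (cproj (# 1) ∷ []))

ifOne-halts : ∀ {X} → Eval X ifOne (1 ∷ []) 0
ifOne-halts = ev-mu (ev-comp (evv-∷ ev-proj evv-[]) (ev-recS (ev-rec0 Semantics.oneE) ev-proj)) (λ z ())

keepOnes : TuringFunctional → TuringFunctional
keepOnes ψ = ccomp (ccomp one (ifOne ∷ [])) (ψ ∷ [])

keepOnes-inv : ∀ {X} ψ n v → keepOnes ψ ^ X [ n ]⇓ v → v ≡ 1 × ψ ^ X [ n ]⇓ 1
keepOnes-inv ψ n v
  (ev-comp (evv-∷ ψn evv-[])
           (ev-comp (evv-∷ (ev-mu (ev-comp (evv-∷ ev-proj evv-[]) stop) _) evv-[])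
                    (ev-comp (evv-∷ ev-zero evv-[]) ev-succ)))
  with notOne-zero stop
... | refl = refl , ψn

keepOnes-intro : ∀ {X} ψ n → ψ ^ X [ n ]⇓ 1 → keepOnes ψ ^ X [ n ]⇓ 1
keepOnes-intro ψ n ψn =
  ev-comp (evv-∷ ψn evv-[]) (ev-comp (evv-∷ ifOne-halts evv-[]) Semantics.oneE)

keepOnes-onlyOnes : ∀ ψ → OnlyOutputsOnes (keepOnes ψ)
keepOnes-onlyOnes ψ X n v out = proj₁ (keepOnes-inv ψ n v out)

-- If ψ computes a density-1 real A generically from O, so does keepOnes ψ:
-- on dom ψ ∩ A the output of ψ is 1.
keepOnes-generic : ∀ {ψ O A} → Density1Real A → IsGenericComputation ψ O A →
                   IsGenericComputation (keepOnes ψ) O A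
keepOnes-generic {ψ} {O} {A} dA (dψ , _ , correct) =
  Density1-∩ halts dψ dA ,
  (λ n v out → subst (_≤ 1) (sym (proj₁ (keepOnes-inv ψ n v out))) ≤-refl) ,
  (λ n v out → let (v≡1 , ψn) = keepOnes-inv ψ n v out in trans v≡1 (correct n 1 ψn))
  where
  halts : ∀ n → (∃ λ v → ψ ^ O [ n ]⇓ v) → A n ≡ true → ∃ λ v → keepOnes ψ ^ O [ n ]⇓ v
  halts n (v , ψn) n∈A = 1 , keepOnes-intro ψ n (subst (ψ ^ O [ n ]⇓_) (trans (correct n v ψn) (cong bit n∈A)) ψn)

mainTheorem14 : (A B : Real) → Density1Real A →
    ((B ≥g A) ⇔ (Σ TuringFunctional λ φ → OnlyOutputsOnes φ ×
    (∀ (O : Real) → IsGenericOracle O B → IsGenericComputation φ O A)))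
    × ((A ≥g B) ⇔ (Σ TuringFunctional λ φ →
    ∀ (O : Real) → IsGenericOracle O A → (∀ n → dom O n → A n ≡ true) →
    IsGenericComputation φ O B))
mainTheorem14 A B dA =
  mk⇔ (λ (ψ , H) → keepOnes ψ , keepOnes-onlyOnes ψ , λ O gO → keepOnes-generic dA (H O gO))
      (λ (φ , _ , H) → φ , H) ,
  mk⇔ (λ (φ , H) → φ , λ O gO _ → H O gO)
      (λ (φ , H) → restrict positiveQueryC φ , λ O gO →
         Restriction.restrict-generic O positiveQueryC positiveQuery? positiveQueryE φ
           (H (positivePart O) (positivePart-generic {O} dA gO) (positivePart-dom⊆ {O} (proj₁ gO))))
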